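{- Let $X=\{a,b\}$, let $u$ be a nonempty finite non-periodic word over $X$ and $W=u^\infty$. Let $v_0,\dots,v_n$ be all forks of $W$ ordered so that $z_0\le\dots\le z_n$ with $z_i=z(v_i)$, $v_0=W$, $v_n=\Lambda$. Let $v_i$ be an exceptional fork and let $v_j=\Psi(v_i)$. Then $z_j\le z_{j-1}+z_{i-1}$.
   Context: A nonempty finite word is periodic if it equals $v^m$ for some word $v$ and $m\ge2$. $W=u^\infty$ is the two-sided infinite word with period $u=u_1\dots u_d$; $\Lambda$ is the empty word. A fork is a finite word $v$ such that $va,vb,av,bv$ are all subwords of $W$; by convention $W$ itself is also a fork. Significance: for a finite word $v$ of length $t$, $z(v)=|\{1\le i\le d:u_i\dots u_{i+t-1}=v\}|$ with cyclic indices; $z(W)=1$. An index $i\ge2$ (and $v_i$) is exceptional if $z_i>z_{i-1}+z_{i-2}$. For exceptional $v_i$, $\Psi(v_i)$ is the longest proper prefix of $v_{i-1}$ that is a fork. -}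

module Defs where

open import Data.Nat using (ℕ; zero; suc; _+_; _≤_; _<_)
open import Data.List using (List; []; _∷_; _∷ʳ_; _++_; length; take; drop; concat; replicate; filter; upTo)
open import Data.Product using (Σ; ∃; _×_; _,_)
open import Data.Unit using (⊤)
open import Relation.Nullary using (¬_; Dec; yes; no)
open import Relation.Binary.PropositionalEquality using (_≡_; _≢_; refl)
import Data.List.Properties as LP

data X : Set where
  a b : X

_≟X_ : (x y : X) → Dec (x ≡ y)
a ≟X a = yes refl
a ≟X b = no (λ ())
b ≟X a = no (λ ())
b ≟X b = yes refl

Word : Set
Word = List X

_≟W_ : (v w : Word) → Dec (v ≡ w)
_≟W_ = LP.≡-dec _≟X_

Periodic : Word → Set
Periodic u = Σ Word λ v → Σ ℕ λ m → (2 ≤ m) × (u ≡ concat (replicate m v))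

-- window u i t = u_{i+1} … u_{i+t} read cyclically in u (0-based start i),
-- i.e. the length-t factor of W = u^∞ starting at position i of a period.
-- (Meaningful for nonempty u: suc (i + t) copies of u have length ≥ i + t.)
window : Word → ℕ → ℕ → Word
window u i t = take t (drop i (concat (replicate (suc (i + t)) u)))

Subword : Word → Word → Set
Subword u w = Σ ℕ λ i → (i < length u) × (window u i (length w) ≡ w)

z : Word → Word → ℕ
z u v = length (filter (λ i → window u i (length v) ≟W v) (upTo (length u)))

data Fk : Set where
  W   : Fk
  fin : Word → Fk

IsFork : Word → Fk → Set
IsFork u W = ⊤
IsFork u (fin v) =
  Subword u (v ∷ʳ a) × Subword u (v ∷ʳ b) × Subword u (a ∷ v) × Subword u (b ∷ v)

zF : Word → Fk → ℕ
zF u W = 1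
zF u (fin v) = z u v

ProperPrefix : Word → Word → Set
ProperPrefix p w = Σ Word λ s → (s ≢ []) × (p ++ s ≡ w)

-- p = Ψ-value for w: the longest proper prefix of w that is a fork of u^∞.
IsLongestForkPrefix : Word → Word → Word → Set
IsLongestForkPrefix u w p =
  ProperPrefix p w × IsFork u (fin p) ×
  (∀ q → ProperPrefix q w → IsFork u (fin q) → length q ≤ length p)

IsForkEnumeration : Word → ℕ → (ℕ → Fk) → Set
IsForkEnumeration u n v =
  (∀ k → k ≤ n → IsFork u (v k)) ×
  (∀ f → IsFork u f → Σ ℕ λ k → (k ≤ n) × (v k ≡ f)) ×
  (∀ k l → k ≤ n → l ≤ n → v k ≡ v l → k ≡ l) ×
  (∀ k l → k ≤ l → l ≤ n → zF u (v k) ≤ zF u (v l)) ×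
  (v 0 ≡ W) ×
  (v n ≡ fin [])

module Submission where

-- Write w = v (i ∸ 1) = p c y with p = Ψ (v i). A proper prefix of w longer than p cannot be
-- right special: its left extensions come from those of the fork w, so it would be a longer
-- fork prefix. Hence the significance does not change from p c to w, and
-- z p = z (p c) + z (p c′) = z w + z (p c′), where c′ is the other letter.
-- Every factor s of u^∞ has a fork of the same significance: W if z s = 1, and if z s ≥ 2 one
-- extends s on a side where it is not special, which keeps z s. The extension must stop at a
-- fork, because a factor of length ≥ |u| occurring twice in one period makes u periodic.
-- So some fork has significance z (p c′) < z p, hence z (p c′) ≤ z (v (j ∸ 1)).

open import Defs
open import Data.Nat using (ℕ; zero; suc; _+_; _*_; _∸_; _≤_; _<_; z≤n; s≤s; s≤s⁻¹; _≤?_; NonZero)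
open import Data.Nat.Properties
open import Algebra.Properties.CommutativeSemigroup +-commutativeSemigroup using (interchange; xy∙z≈xz∙y)
open import Data.Nat.DivMod using (_%_; _/_; m≡m%n+[m/n]*n; m%n<n)
open import Data.Nat.Tactic.RingSolver using (solve-∀)
open import Data.List using (List; []; _∷_; _∷ʳ_; _++_; [_]; length; take; drop; concat; replicate; filter; upTo)
open import Data.List.Properties
  using (∷-injective; ∷-injectiveˡ; ∷-injectiveʳ; ∷ʳ-injective; length-++; ++-assoc; ++-identityʳ;
         ++-cancelˡ; filter-++; filter-≐; upTo-∷ʳ)
open import Data.Product using (Σ; _×_; _,_; proj₁; proj₂)
open import Data.Sum using (_⊎_; inj₁; inj₂)
import Data.Sum as Sum
open import Data.Empty using (⊥; ⊥-elim)
open import Function using (_∘_)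
open import Relation.Nullary using (¬_; Dec; yes; no)
open import Relation.Nullary.Decidable using (map′; _×-dec_)
open import Relation.Unary using (Decidable; _≐_)
open import Relation.Binary.PropositionalEquality
  using (_≡_; _≢_; refl; sym; trans; cong; cong₂; subst; module ≡-Reasoning)
open ≡-Reasoning

indicator : {Q : Set} → Dec Q → ℕ
indicator (yes _) = 1
indicator (no _) = 0

indicator-cong : {P Q : Set} (p : Dec P) (q : Dec Q) → (P → Q) → (Q → P) → indicator p ≡ indicator q
indicator-cong (yes _) (yes _) _ _ = refl
indicator-cong (no _) (no _) _ _ = refl
indicator-cong (yes P) (no ¬Q) P⇒Q _ = ⊥-elim (¬Q (P⇒Q P))
indicator-cong (no ¬P) (yes Q) _ Q⇒P = ⊥-elim (¬P (Q⇒P Q))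

indicator-⊎ : {P Q R : Set} (p : Dec P) (q : Dec Q) (r : Dec R) →
  (P → Q ⊎ R) → (Q → P) → (R → P) → (Q → R → ⊥) →
  indicator p ≡ indicator q + indicator r
indicator-⊎ (yes _) (yes Q) (yes R) _ _ _ disjoint = ⊥-elim (disjoint Q R)
indicator-⊎ (yes _) (yes _) (no _) _ _ _ _ = refl
indicator-⊎ (yes _) (no _) (yes _) _ _ _ _ = refl
indicator-⊎ (yes P) (no ¬Q) (no ¬R) split _ _ _ = ⊥-elim (Sum.[ ¬Q , ¬R ] (split P))
indicator-⊎ (no ¬P) (yes Q) _ _ Q⇒P _ _ = ⊥-elim (¬P (Q⇒P Q))
indicator-⊎ (no ¬P) (no _) (yes R) _ _ R⇒P _ = ⊥-elim (¬P (R⇒P R))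
indicator-⊎ (no _) (no _) (no _) _ _ _ _ = refl

count : {P : ℕ → Set} → Decidable P → ℕ → ℕ
count P? zero = 0
count P? (suc n) = count P? n + indicator (P? n)

length-filter-upTo : {P : ℕ → Set} (P? : Decidable P) (n : ℕ) → length (filter P? (upTo n)) ≡ count P? n
length-filter-upTo P? zero = refl
length-filter-upTo P? (suc n) = begin
  length (filter P? (upTo (suc n)))                       ≡⟨ cong (length ∘ filter P?) (upTo-∷ʳ n) ⟨
  length (filter P? (upTo n ++ [ n ]))                    ≡⟨ cong length (filter-++ P? (upTo n) [ n ]) ⟩
  length (filter P? (upTo n) ++ filter P? [ n ])          ≡⟨ length-++ (filter P? (upTo n)) ⟩
  length (filter P? (upTo n)) + length (filter P? [ n ])  ≡⟨ cong₂ _+_ (length-filter-upTo P? n) singleton ⟩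
  count P? n + indicator (P? n)                           ∎
  where
  singleton : length (filter P? [ n ]) ≡ indicator (P? n)
  singleton with P? n
  ... | yes _ = refl
  ... | no _ = refl

count-split : {P Q R : ℕ → Set} (P? : Decidable P) (Q? : Decidable Q) (R? : Decidable R) →
  (∀ i → indicator (P? i) ≡ indicator (Q? i) + indicator (R? i)) →
  ∀ n → count P? n ≡ count Q? n + count R? n
count-split P? Q? R? split zero = refl
count-split P? Q? R? split (suc n) = begin
  count P? n + indicator (P? n)
    ≡⟨ cong₂ _+_ (count-split P? Q? R? split n) (split n) ⟩
  (count Q? n + count R? n) + (indicator (Q? n) + indicator (R? n))
    ≡⟨ interchange (count Q? n) _ _ _ ⟩
  count Q? (suc n) + count R? (suc n) ∎

count-suc : {P : ℕ → Set} (P? : Decidable P) (n : ℕ) →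
  count (λ i → P? (suc i)) n + indicator (P? 0) ≡ count P? n + indicator (P? n)
count-suc P? zero = refl
count-suc P? (suc n) = begin
  count (λ i → P? (suc i)) n + indicator (P? (suc n)) + indicator (P? 0)
    ≡⟨ xy∙z≈xz∙y (count (λ i → P? (suc i)) n) _ _ ⟩
  count (λ i → P? (suc i)) n + indicator (P? 0) + indicator (P? (suc n))
    ≡⟨ cong (_+ indicator (P? (suc n))) (count-suc P? n) ⟩
  count P? n + indicator (P? n) + indicator (P? (suc n)) ∎

count-rotate : {P : ℕ → Set} (P? : Decidable P) (n : ℕ) → (P 0 → P n) → (P n → P 0) →
  count (λ i → P? (suc i)) n ≡ count P? n
count-rotate P? n P0⇒Pn Pn⇒P0 = +-cancelʳ-≡ (indicator (P? 0)) _ _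
  (trans (count-suc P? n) (cong (count P? n +_) (indicator-cong (P? n) (P? 0) Pn⇒P0 P0⇒Pn)))

1≤count⇒∃ : {P : ℕ → Set} (P? : Decidable P) (n : ℕ) → 1 ≤ count P? n → Σ ℕ λ i → i < n × P i
1≤count⇒∃ P? (suc n) pos with P? n
... | yes Pn = n , ≤-refl , Pn
... | no _ with i , i<n , Pi ← 1≤count⇒∃ P? n (subst (1 ≤_) (+-identityʳ _) pos) = i , m≤n⇒m≤1+n i<n , Pi

∃⇒1≤count : {P : ℕ → Set} (P? : Decidable P) {n i : ℕ} → i < n → P i → 1 ≤ count P? n
∃⇒1≤count P? {suc n} {i} i<1+n Pi with P? n | m<1+n⇒m<n∨m≡n i<1+n
... | yes _ | _ = m≤n+m 1 _
... | no _ | inj₁ i<n = subst (1 ≤_) (sym (+-identityʳ _)) (∃⇒1≤count P? i<n Pi)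
... | no ¬Pn | inj₂ refl = ⊥-elim (¬Pn Pi)

2≤count⇒∃₂ : {P : ℕ → Set} (P? : Decidable P) (n : ℕ) → 2 ≤ count P? n →
  Σ ℕ λ i → Σ ℕ λ j → i < j × j < n × P i × P j
2≤count⇒∃₂ P? (suc n) two with P? n
... | yes Pn with i , i<n , Pi ← 1≤count⇒∃ P? n (s≤s⁻¹ (subst (2 ≤_) (+-comm _ 1) two)) =
  i , n , i<n , ≤-refl , Pi , Pn
... | no _ with i , j , i<j , j<n , Pi , Pj ← 2≤count⇒∃₂ P? n (subst (2 ≤_) (+-identityʳ _) two) =
  i , j , i<j , m≤n⇒m≤1+n j<n , Pi , Pj

slice : {A : Set} → (ℕ → A) → ℕ → ℕ → List A
slice f i zero = []
slice f i (suc t) = f i ∷ slice f (suc i) t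

module _ {A : Set} where

  length-slice : ∀ (f : ℕ → A) i t → length (slice f i t) ≡ t
  length-slice f i zero = refl
  length-slice f i (suc t) = cong suc (length-slice f (suc i) t)

  slice-suc : ∀ (f : ℕ → A) i t → slice f (suc i) t ≡ slice (λ k → f (suc k)) i t
  slice-suc f i zero = refl
  slice-suc f i (suc t) = cong (f (suc i) ∷_) (slice-suc f (suc i) t)

  slice-≗ : ∀ {f g : ℕ → A} → (∀ k → f k ≡ g k) → ∀ i t → slice f i t ≡ slice g i t
  slice-≗ f≗g i zero = refl
  slice-≗ f≗g i (suc t) = cong₂ _∷_ (f≗g i) (slice-≗ f≗g (suc i) t)

  slice-shift : ∀ (f : ℕ → A) {r} → (∀ m → f (m + r) ≡ f m) → ∀ i t → slice f (i + r) t ≡ slice f i t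
  slice-shift f shift i zero = refl
  slice-shift f shift i (suc t) = cong₂ _∷_ (shift i) (slice-shift f shift (suc i) t)

  slice-++ : ∀ (f : ℕ → A) i m n → slice f i (m + n) ≡ slice f i m ++ slice f (i + m) n
  slice-++ f i zero n = cong (λ j → slice f j n) (sym (+-identityʳ i))
  slice-++ f i (suc m) n = cong (f i ∷_) (begin
    slice f (suc i) (m + n)                    ≡⟨ slice-++ f (suc i) m n ⟩
    slice f (suc i) m ++ slice f (suc i + m) n ≡⟨ cong (λ j → slice f (suc i) m ++ slice f j n) (+-suc i m) ⟨
    slice f (suc i) m ++ slice f (i + suc m) n ∎)

  slice-∷ʳ : ∀ (f : ℕ → A) i t → slice f i (suc t) ≡ slice f i t ∷ʳ f (i + t)
  slice-∷ʳ f i t = trans (cong (slice f i) (+-comm 1 t)) (slice-++ f i t 1)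

  slice-≡⇒ : ∀ (f : ℕ → A) i j t → slice f i t ≡ slice f j t → ∀ k → k < t → f (i + k) ≡ f (j + k)
  slice-≡⇒ f i j (suc t) eq zero _ = begin
    f (i + 0) ≡⟨ cong f (+-identityʳ i) ⟩
    f i       ≡⟨ ∷-injectiveˡ eq ⟩
    f j       ≡⟨ cong f (+-identityʳ j) ⟨
    f (j + 0) ∎
  slice-≡⇒ f i j (suc t) eq (suc k) k<t = begin
    f (i + suc k) ≡⟨ cong f (+-suc i k) ⟩
    f (suc i + k) ≡⟨ slice-≡⇒ f (suc i) (suc j) t (∷-injectiveʳ eq) k (s≤s⁻¹ k<t) ⟩
    f (suc j + k) ≡⟨ cong f (+-suc j k) ⟨
    f (j + suc k) ∎

module PeriodicFunction {A : Set} (f : ℕ → A) (d : ℕ) .{{_ : NonZero d}}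
                         (periodic : ∀ k → f (k + d) ≡ f k) where

  periodic-* : ∀ k q → f (k + q * d) ≡ f k
  periodic-* k zero = cong f (+-identityʳ k)
  periodic-* k (suc q) = begin
    f (k + (d + q * d)) ≡⟨ cong (λ m → f (k + m)) (+-comm d (q * d)) ⟩
    f (k + (q * d + d)) ≡⟨ cong f (+-assoc k (q * d) d) ⟨
    f (k + q * d + d)   ≡⟨ periodic (k + q * d) ⟩
    f (k + q * d)       ≡⟨ periodic-* k q ⟩
    f k                 ∎

  repeated-window⇒period : ∀ i r → (∀ k → k < d → f (i + k) ≡ f (i + r + k)) → ∀ m → f (m + r) ≡ f m
  repeated-window⇒period i r same m = begin
    f (m + r)                 ≡⟨ periodic-* (m + r) i ⟨
    f (m + r + i * d)         ≡⟨ cong (λ n → f (m + r + n)) i+e≡i*d ⟨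
    f (m + r + (i + e))       ≡⟨ cong f (rearrangeʳ m r i e) ⟩
    f (i + r + (e + m))       ≡⟨ shifted (e + m) ⟩
    f (i + (e + m))           ≡⟨ cong f (rearrangeˡ m i e) ⟩
    f (m + (i + e))           ≡⟨ cong (λ n → f (m + n)) i+e≡i*d ⟩
    f (m + i * d)             ≡⟨ periodic-* m i ⟩
    f m                       ∎
    where
    e : ℕ
    e = i * d ∸ i
    i+e≡i*d : i + e ≡ i * d
    i+e≡i*d = m+[n∸m]≡n (m≤m*n i d)
    rearrangeʳ : ∀ m r i e → m + r + (i + e) ≡ i + r + (e + m)
    rearrangeʳ = solve-∀
    rearrangeˡ : ∀ m i e → i + (e + m) ≡ m + (i + e)
    rearrangeˡ = solve-∀
    shifted : ∀ k → f (i + r + k) ≡ f (i + k)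
    shifted k = begin
      f (i + r + k)                         ≡⟨ cong (λ x → f (i + r + x)) (m≡m%n+[m/n]*n k d) ⟩
      f (i + r + (k % d + k / d * d))       ≡⟨ cong f (+-assoc (i + r) (k % d) _) ⟨
      f (i + r + k % d + k / d * d)         ≡⟨ periodic-* (i + r + k % d) (k / d) ⟩
      f (i + r + k % d)                     ≡⟨ same (k % d) (m%n<n k d) ⟨
      f (i + k % d)                         ≡⟨ periodic-* (i + k % d) (k / d) ⟨
      f (i + k % d + k / d * d)             ≡⟨ cong f (+-assoc i (k % d) _) ⟩
      f (i + (k % d + k / d * d))           ≡⟨ cong (λ x → f (i + x)) (m≡m%n+[m/n]*n k d) ⟨
      f (i + k)                             ∎

power : {A : Set} → ℕ → List A → List A
power m v = concat (replicate m v)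

module _ {A : Set} where

  power-+ : ∀ m n (v : List A) → power (m + n) v ≡ power m v ++ power n v
  power-+ zero n v = refl
  power-+ (suc m) n v = trans (cong (v ++_) (power-+ m n v)) (sym (++-assoc v (power m v) (power n v)))

  length-∷ʳ : ∀ (s : List A) x → length (s ∷ʳ x) ≡ suc (length s)
  length-∷ʳ s x = trans (length-++ s) (+-comm (length s) 1)

  ++-prefix : ∀ (x y z w : List A) → x ++ y ≡ z ++ w → length x ≤ length z → Σ (List A) λ e → z ≡ x ++ e
  ++-prefix [] _ z _ _ _ = z , refl
  ++-prefix (c ∷ x) y (c′ ∷ z) w eq le with refl , eq′ ← ∷-injective eq
    with e , z≡x++e ← ++-prefix x y z w eq′ (s≤s⁻¹ le) = e , cong (c ∷_) z≡x++e

  ++-injectiveˡ : ∀ (x z : List A) {y w} → length x ≡ length z → x ++ y ≡ z ++ w → x ≡ z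
  ++-injectiveˡ [] [] _ _ = refl
  ++-injectiveˡ (c ∷ x) (c′ ∷ z) len eq with refl , eq′ ← ∷-injective eq =
    cong (c ∷_) (++-injectiveˡ x z (suc-injective len) eq′)

  CommonPower : List A → List A → Set
  CommonPower x y = Σ (List A) λ v → Σ ℕ λ p → Σ ℕ λ q → x ≡ power p v × y ≡ power q v

  commuting⇒common-power : ∀ x y → x ++ y ≡ y ++ x → CommonPower x y
  commuting⇒common-power x y = go (length x + length y) x y ≤-refl
    where
    prepend : ∀ {x y} → CommonPower x y → CommonPower x (x ++ y)
    prepend (v , p , q , refl , refl) = v , p , p + q , refl , sym (power-+ p q v)

    swap : ∀ {x y} → CommonPower x y → CommonPower y x
    swap (v , p , q , x≡ , y≡) = v , q , p , y≡ , x≡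

    peel : ∀ x y′ → x ++ (x ++ y′) ≡ (x ++ y′) ++ x → x ++ y′ ≡ y′ ++ x
    peel x y′ eq = ++-cancelˡ x _ _ (trans eq (++-assoc x y′ x))

    shorter : ∀ x y′ m {n} → 1 ≤ m → m + length (x ++ y′) ≤ suc n → length x + length y′ ≤ n
    shorter x y′ m pos bound = s≤s⁻¹ (≤-trans (subst (_< m + length (x ++ y′)) (length-++ x) (m<n+m _ pos)) bound)

    go : ∀ n x y → length x + length y ≤ n → x ++ y ≡ y ++ x → CommonPower x y
    go _ [] y _ _ = y , 0 , 1 , refl , sym (++-identityʳ y)
    go _ x [] _ _ = x , 1 , 0 , sym (++-identityʳ x) , refl
    go zero (_ ∷ _) (_ ∷ _) () _
    go (suc n) x@(_ ∷ _) y@(_ ∷ _) bound comm with ≤-total (length x) (length y)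
    ... | inj₁ |x|≤|y| with y′ , refl ← ++-prefix x y y x comm |x|≤|y| =
      prepend (go n x y′ (shorter x y′ (length x) (s≤s z≤n) bound) (peel x y′ comm))
    ... | inj₂ |y|≤|x| with x′ , refl ← ++-prefix y x x y (sym comm) |y|≤|x| =
      swap (prepend (go n y x′ (shorter y x′ (length y) (s≤s z≤n) (subst (_≤ suc n) (+-comm _ (length y)) bound))
                                (peel y x′ (sym comm))))

commuting⇒periodic : ∀ {x y : Word} → x ++ y ≡ y ++ x → 1 ≤ length x → 1 ≤ length y → Periodic (x ++ y)
commuting⇒periodic {x} {y} comm |x|≥1 |y|≥1 with commuting⇒common-power x y comm
... | v , p , q , refl , refl = v , p + q , +-mono-≤ (exponent-pos p |x|≥1) (exponent-pos q |y|≥1) , sym (power-+ p q v)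
  where
  exponent-pos : ∀ p {v} → 1 ≤ length (power p v) → 1 ≤ p
  exponent-pos (suc p) _ = s≤s z≤n

other : X → X
other a = b
other b = a

≡-or-other : ∀ x y → y ≡ x ⊎ y ≡ other x
≡-or-other a a = inj₁ refl
≡-or-other a b = inj₂ refl
≡-or-other b a = inj₂ refl
≡-or-other b b = inj₁ refl

x≢other : ∀ x → x ≢ other x
x≢other a ()
x≢other b ()

fork-below⇒≤-previous : ∀ {u n v} → IsForkEnumeration u n v → ∀ j → j ≤ n →
  ∀ {F} → IsFork u F → zF u F < zF u (v j) → zF u F ≤ zF u (v (j ∸ 1))
fork-below⇒≤-previous (_ , complete , _ , sorted , _) j j≤n fork-F F<vj with complete _ fork-F
... | m , m≤n , refl with j ≤? m
...   | yes j≤m = ⊥-elim (<⇒≱ F<vj (sorted j m j≤m m≤n))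
...   | no j≰m = sorted m (j ∸ 1) (∸-monoˡ-≤ 1 (≰⇒> j≰m)) (≤-trans (m∸n≤m j 1) j≤n)

module CyclicWord (x₀ : X) (xs : Word) where

  u : Word
  u = x₀ ∷ xs

  d : ℕ
  d = length u

  -- U⁺ r k is the letter at position k of the infinite word r u u u …, and U = U⁺ u is u^∞.
  U⁺ : Word → ℕ → X
  U⁺ [] zero = x₀
  U⁺ [] (suc k) = U⁺ xs k
  U⁺ (y ∷ r) zero = y
  U⁺ (y ∷ r) (suc k) = U⁺ r k

  U : ℕ → X
  U = U⁺ u

  U⁺-[] : ∀ k → U⁺ [] k ≡ U k
  U⁺-[] zero = refl
  U⁺-[] (suc k) = refl

  U⁺-++ : ∀ r k → U⁺ r (length r + k) ≡ U k
  U⁺-++ [] k = U⁺-[] k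
  U⁺-++ (y ∷ r) k = U⁺-++ r k

  U-periodic : ∀ k → U (k + d) ≡ U k
  U-periodic k = trans (cong U (+-comm k d)) (U⁺-++ u k)

  slice-U⁺ : ∀ r → slice (U⁺ r) 0 (length r) ≡ r
  slice-U⁺ [] = refl
  slice-U⁺ (y ∷ r) = cong (y ∷_) (trans (slice-suc (U⁺ (y ∷ r)) 0 (length r)) (slice-U⁺ r))

  slice-U : slice U 0 d ≡ u
  slice-U = slice-U⁺ u

  take-drop-power : ∀ N r i t → i + t ≤ length r + N * d → take t (drop i (r ++ power N u)) ≡ slice (U⁺ r) i t
  take-drop-power N r i zero _ = refl
  take-drop-power N (y ∷ r) (suc i) t bound =
    trans (take-drop-power N r i t (s≤s⁻¹ bound)) (sym (slice-suc (U⁺ (y ∷ r)) i t))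
  take-drop-power N (y ∷ r) zero (suc t) bound =
    cong (y ∷_) (trans (take-drop-power N r 0 t (s≤s⁻¹ bound)) (sym (slice-suc (U⁺ (y ∷ r)) 0 t)))
  take-drop-power (suc N) [] i (suc t) bound =
    trans (take-drop-power N u i (suc t) bound) (slice-≗ (sym ∘ U⁺-[]) i (suc t))
  take-drop-power zero [] i (suc t) bound = ⊥-elim (m+1+n≰m i (≤-trans bound z≤n))

  window≡slice : ∀ i t → window u i t ≡ slice U i t
  window≡slice i t = trans (take-drop-power (suc (i + t)) [] i t bound) (slice-≗ U⁺-[] i t)
    where
    bound : i + t ≤ suc (i + t) * d
    bound = ≤-trans (n≤1+n (i + t)) (m≤m*n (suc (i + t)) d)

  window? : ∀ s i → Dec (window u i (length s) ≡ s)
  window? s i = window u i (length s) ≟W s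

  subword⇒1≤z : ∀ {s} → Subword u s → 1 ≤ z u s
  subword⇒1≤z {s} (i , i<d , occ) =
    subst (1 ≤_) (sym (length-filter-upTo (window? s) d)) (∃⇒1≤count (window? s) i<d occ)

  1≤z⇒subword : ∀ {s} → 1 ≤ z u s → Subword u s
  1≤z⇒subword {s} pos = 1≤count⇒∃ (window? s) d (subst (1 ≤_) (length-filter-upTo (window? s) d) pos)

  subword? : ∀ s → Dec (Subword u s)
  subword? s = map′ 1≤z⇒subword subword⇒1≤z (1 ≤? z u s)

  ¬subword⇒z≡0 : ∀ {s} → ¬ Subword u s → z u s ≡ 0
  ¬subword⇒z≡0 ¬sub = n<1⇒n≡0 (≰⇒> (¬sub ∘ 1≤z⇒subword))

  Occurs : Word → ℕ → Set
  Occurs s i = slice U i (length s) ≡ s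

  occurs? : ∀ s → Decidable (Occurs s)
  occurs? s i = slice U i (length s) ≟W s

  z≡count : ∀ s → z u s ≡ count (occurs? s) d
  z≡count s = trans (cong length (filter-≐ (window? s) (occurs? s) window⇔occurs (upTo d)))
                    (length-filter-upTo (occurs? s) d)
    where
    window⇔occurs : (λ i → window u i (length s) ≡ s) ≐ Occurs s
    window⇔occurs = (λ {i} occ → trans (sym (window≡slice i _)) occ) , (λ {i} occ → trans (window≡slice i _) occ)

  occurs-++ˡ : ∀ q r i → Occurs (q ++ r) i → Occurs q i
  occurs-++ˡ q r i occ = ++-injectiveˡ (slice U i (length q)) q (length-slice U i (length q)) (begin
    slice U i (length q) ++ slice U (i + length q) (length r) ≡⟨ slice-++ U i (length q) (length r) ⟨
    slice U i (length q + length r)                          ≡⟨ cong (slice U i) (length-++ q) ⟨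
    slice U i (length (q ++ r))                              ≡⟨ occ ⟩
    q ++ r                                                   ∎)

  subword-++ˡ : ∀ q r → Subword u (q ++ r) → Subword u q
  subword-++ˡ q r (i , i<d , occ) =
    i , i<d , trans (window≡slice i (length q)) (occurs-++ˡ q r i (trans (sym (window≡slice i _)) occ))

  occurs-∷ʳ⁻ : ∀ {s x i} → Occurs (s ∷ʳ x) i → Occurs s i × U (i + length s) ≡ x
  occurs-∷ʳ⁻ {s} {x} {i} occ = ∷ʳ-injective (slice U i (length s)) s (begin
    slice U i (length s) ∷ʳ U (i + length s) ≡⟨ slice-∷ʳ U i (length s) ⟨
    slice U i (suc (length s))               ≡⟨ cong (slice U i) (length-∷ʳ s x) ⟨
    slice U i (length (s ∷ʳ x))              ≡⟨ occ ⟩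
    s ∷ʳ x                                   ∎)

  occurs-∷ʳ⁺ : ∀ {s x i} → Occurs s i → U (i + length s) ≡ x → Occurs (s ∷ʳ x) i
  occurs-∷ʳ⁺ {s} {x} {i} occ next = begin
    slice U i (length (s ∷ʳ x))              ≡⟨ cong (slice U i) (length-∷ʳ s x) ⟩
    slice U i (suc (length s))               ≡⟨ slice-∷ʳ U i (length s) ⟩
    slice U i (length s) ∷ʳ U (i + length s) ≡⟨ cong₂ _∷ʳ_ occ next ⟩
    s ∷ʳ x                                   ∎

  z-∷ʳ : ∀ s x → z u s ≡ z u (s ∷ʳ x) + z u (s ∷ʳ other x)
  z-∷ʳ s x = begin
    z u s                                                      ≡⟨ z≡count s ⟩
    count (occurs? s) d                                        ≡⟨ count-split _ _ _ split d ⟩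
    count (occurs? (s ∷ʳ x)) d + count (occurs? (s ∷ʳ other x)) d ≡⟨ cong₂ _+_ (z≡count _) (z≡count _) ⟨
    z u (s ∷ʳ x) + z u (s ∷ʳ other x)                          ∎
    where
    split : ∀ i → indicator (occurs? s i) ≡ indicator (occurs? (s ∷ʳ x) i) + indicator (occurs? (s ∷ʳ other x) i)
    split i = indicator-⊎ (occurs? s i) (occurs? (s ∷ʳ x) i) (occurs? (s ∷ʳ other x) i)
      (λ occ → Sum.map (occurs-∷ʳ⁺ occ) (occurs-∷ʳ⁺ occ) (≡-or-other x (U (i + length s))))
      (proj₁ ∘ occurs-∷ʳ⁻) (proj₁ ∘ occurs-∷ʳ⁻)
      (λ occ occ′ → x≢other x (trans (sym (proj₂ (occurs-∷ʳ⁻ occ))) (proj₂ (occurs-∷ʳ⁻ occ′))))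

  z-∷ : ∀ s x → z u s ≡ z u (x ∷ s) + z u (other x ∷ s)
  z-∷ s x = begin
    z u s                                                       ≡⟨ z≡count s ⟩
    count (occurs? s) d                                         ≡⟨ count-rotate (occurs? s) d occurs-0⇒d occurs-d⇒0 ⟨
    count (λ i → occurs? s (suc i)) d                           ≡⟨ count-split _ _ _ split d ⟩
    count (occurs? (x ∷ s)) d + count (occurs? (other x ∷ s)) d ≡⟨ cong₂ _+_ (z≡count _) (z≡count _) ⟨
    z u (x ∷ s) + z u (other x ∷ s)                             ∎
    where
    occurs-0⇒d : Occurs s 0 → Occurs s d
    occurs-0⇒d = trans (slice-shift U U-periodic 0 (length s))
    occurs-d⇒0 : Occurs s d → Occurs s 0
    occurs-d⇒0 = trans (sym (slice-shift U U-periodic 0 (length s)))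
    split : ∀ i → indicator (occurs? s (suc i)) ≡ indicator (occurs? (x ∷ s) i) + indicator (occurs? (other x ∷ s) i)
    split i = indicator-⊎ (occurs? s (suc i)) (occurs? (x ∷ s) i) (occurs? (other x ∷ s) i)
      (λ occ → Sum.map (λ e → cong₂ _∷_ e occ) (λ e → cong₂ _∷_ e occ) (≡-or-other x (U i)))
      ∷-injectiveʳ ∷-injectiveʳ
      (λ occ occ′ → x≢other x (trans (sym (∷-injectiveˡ occ)) (∷-injectiveˡ occ′)))

  period⇒periodic : ∀ r → 0 < r → r < d → (∀ m → U (m + r) ≡ U m) → Periodic u
  period⇒periodic r 0<r r<d shift = subst Periodic (sym u≡xy)
    (commuting⇒periodic {x} {y} (trans (sym u≡xy) u≡yx)
      (subst (1 ≤_) (sym (length-slice U 0 r)) 0<r)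
      (subst (1 ≤_) (sym (length-slice U r (d ∸ r))) (m<n⇒0<n∸m r<d)))
    where
    x y : Word
    x = slice U 0 r
    y = slice U r (d ∸ r)
    r+[d∸r]≡d : r + (d ∸ r) ≡ d
    r+[d∸r]≡d = m+[n∸m]≡n (<⇒≤ r<d)
    u≡xy : u ≡ x ++ y
    u≡xy = begin
      u                      ≡⟨ slice-U ⟨
      slice U 0 d            ≡⟨ cong (slice U 0) r+[d∸r]≡d ⟨
      slice U 0 (r + (d ∸ r)) ≡⟨ slice-++ U 0 r (d ∸ r) ⟩
      x ++ y                 ∎
    u≡yx : u ≡ y ++ x
    u≡yx = begin
      u                                ≡⟨ slice-U ⟨
      slice U 0 d                      ≡⟨ slice-shift U shift 0 d ⟨
      slice U r d                      ≡⟨ cong (slice U r) (trans (+-comm (d ∸ r) r) r+[d∸r]≡d) ⟨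
      slice U r (d ∸ r + r)            ≡⟨ slice-++ U r (d ∸ r) r ⟩
      y ++ slice U (r + (d ∸ r)) r     ≡⟨ cong (λ i → y ++ slice U i r) r+[d∸r]≡d ⟩
      y ++ slice U d r                 ≡⟨ cong (y ++_) (slice-shift U U-periodic 0 r) ⟩
      y ++ x                           ∎

  long-repeat⇒periodic : ∀ t → 2 ≤ z u t → d ≤ length t → Periodic u
  long-repeat⇒periodic t repeated long with 2≤count⇒∃₂ (occurs? t) d (subst (2 ≤_) (z≡count t) repeated)
  ... | i , i′ , i<i′ , i′<d , occ , occ′ =
    period⇒periodic (i′ ∸ i) (m<n⇒0<n∸m i<i′) (≤-<-trans (m∸n≤m i′ i) i′<d)
      (PeriodicFunction.repeated-window⇒period U d U-periodic i (i′ ∸ i) same)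
    where
    same : ∀ k → k < d → U (i + k) ≡ U (i + (i′ ∸ i) + k)
    same k k<d = trans (slice-≡⇒ U i i′ (length t) (trans occ (sym occ′)) k (≤-trans k<d long))
                       (cong (λ j → U (j + k)) (sym (m+[n∸m]≡n (<⇒≤ i<i′))))

  RightSpecial LeftSpecial : Word → Set
  RightSpecial s = Subword u (s ∷ʳ a) × Subword u (s ∷ʳ b)
  LeftSpecial s = Subword u (a ∷ s) × Subword u (b ∷ s)

  rightSpecial : ∀ {s} x → Subword u (s ∷ʳ x) → Subword u (s ∷ʳ other x) → RightSpecial s
  rightSpecial a sub sub′ = sub , sub′
  rightSpecial b sub sub′ = sub′ , sub

  leftSpecial : ∀ {s} x → Subword u (x ∷ s) → Subword u (other x ∷ s) → LeftSpecial s
  leftSpecial a sub sub′ = sub , sub′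
  leftSpecial b sub sub′ = sub′ , sub

  rightSpecial⇒subword : ∀ {s} → RightSpecial s → ∀ x → Subword u (s ∷ʳ x)
  rightSpecial⇒subword (sa , _) a = sa
  rightSpecial⇒subword (_ , sb) b = sb

  z-∷ʳ-¬RightSpecial : ∀ s x → Subword u (s ∷ʳ x) → ¬ RightSpecial s → z u (s ∷ʳ x) ≡ z u s
  z-∷ʳ-¬RightSpecial s x sx ¬rs = sym (begin
    z u s                             ≡⟨ z-∷ʳ s x ⟩
    z u (s ∷ʳ x) + z u (s ∷ʳ other x) ≡⟨ cong (z u (s ∷ʳ x) +_) (¬subword⇒z≡0 (¬rs ∘ rightSpecial x sx)) ⟩
    z u (s ∷ʳ x) + 0                  ≡⟨ +-identityʳ _ ⟩
    z u (s ∷ʳ x)                      ∎)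

  z-∷-¬LeftSpecial : ∀ s x → Subword u (x ∷ s) → ¬ LeftSpecial s → z u (x ∷ s) ≡ z u s
  z-∷-¬LeftSpecial s x xsub ¬ls = sym (begin
    z u s                           ≡⟨ z-∷ s x ⟩
    z u (x ∷ s) + z u (other x ∷ s) ≡⟨ cong (z u (x ∷ s) +_) (¬subword⇒z≡0 (¬ls ∘ leftSpecial x xsub)) ⟩
    z u (x ∷ s) + 0                 ≡⟨ +-identityʳ _ ⟩
    z u (x ∷ s)                     ∎)

  subword-∷ʳ : ∀ {s} → Subword u s → Σ X λ x → Subword u (s ∷ʳ x)
  subword-∷ʳ {s} sub with subword? (s ∷ʳ a)
  ... | yes sa = a , sa
  ... | no ¬sa = b , 1≤z⇒subword (subst (1 ≤_) z≡ (subword⇒1≤z sub))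
    where
    z≡ : z u s ≡ z u (s ∷ʳ b)
    z≡ = trans (z-∷ʳ s a) (cong (_+ z u (s ∷ʳ b)) (¬subword⇒z≡0 ¬sa))

  subword-∷ : ∀ {s} → Subword u s → Σ X λ x → Subword u (x ∷ s)
  subword-∷ {s} sub with subword? (a ∷ s)
  ... | yes as′ = a , as′
  ... | no ¬as = b , 1≤z⇒subword (subst (1 ≤_) z≡ (subword⇒1≤z sub))
    where
    z≡ : z u s ≡ z u (b ∷ s)
    z≡ = trans (z-∷ s a) (cong (_+ z u (b ∷ s)) (¬subword⇒z≡0 ¬as))

  fork-or-extension : ∀ s → Subword u s →
    IsFork u (fin s) ⊎ Σ Word λ s′ → length s′ ≡ suc (length s) × z u s′ ≡ z u s
  fork-or-extension s sub with subword? (s ∷ʳ a) ×-dec subword? (s ∷ʳ b) | subword? (a ∷ s) ×-dec subword? (b ∷ s)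
  ... | yes (sa , sb) | yes (as′ , bs′) = inj₁ (sa , sb , as′ , bs′)
  ... | no ¬rs | _ with x , sx ← subword-∷ʳ sub = inj₂ (s ∷ʳ x , length-∷ʳ s x , z-∷ʳ-¬RightSpecial s x sx ¬rs)
  ... | yes _ | no ¬ls with x , xsub ← subword-∷ sub = inj₂ (x ∷ s , refl , z-∷-¬LeftSpecial s x xsub ¬ls)

  extend-to-fork : ¬ Periodic u → ∀ fuel s → 2 ≤ z u s → d ≤ length s + fuel →
    Σ Word λ f → IsFork u (fin f) × z u f ≡ z u s
  extend-to-fork ¬per zero s repeated long =
    ⊥-elim (¬per (long-repeat⇒periodic s repeated (subst (d ≤_) (+-identityʳ _) long)))
  extend-to-fork ¬per (suc fuel) s repeated long with fork-or-extension s (1≤z⇒subword (≤-trans (n≤1+n 1) repeated))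
  ... | inj₁ fork = s , fork , refl
  ... | inj₂ (s′ , len , zs′≡zs)
    with f , fork , zf≡zs′ ← extend-to-fork ¬per fuel s′ (subst (2 ≤_) (sym zs′≡zs) repeated)
                               (subst (d ≤_) (trans (+-suc (length s) fuel) (cong (_+ fuel) (sym len))) long) =
    f , fork , trans zf≡zs′ zs′≡zs

  fork-of-significance : ¬ Periodic u → ∀ s → Subword u s → Σ Fk λ F → IsFork u F × zF u F ≡ z u s
  fork-of-significance ¬per s sub with z u s ≤? 1
  ... | yes z≤1 = W , _ , ≤-antisym (subword⇒1≤z sub) z≤1
  ... | no z≰1 with f , fork , zf≡ ← extend-to-fork ¬per d s (≰⇒> z≰1) (m≤n+m d (length s)) = fin f , fork , zf≡

  fork⇒subword : ∀ {w} → IsFork u (fin w) → Subword u w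
  fork⇒subword {w} (wa , _) = subword-++ˡ w [ a ] wa

  rightSpecial-prefix-of-fork : ∀ {q r w} → IsFork u (fin w) → q ++ r ≡ w → RightSpecial q → IsFork u (fin q)
  rightSpecial-prefix-of-fork {q} {r} {w} (_ , _ , aw , bw) q++r≡w (qa , qb) = qa , qb , prefix a aw , prefix b bw
    where
    prefix : ∀ x → Subword u (x ∷ w) → Subword u (x ∷ q)
    prefix x xw = subword-++ˡ (x ∷ q) r (subst (λ w → Subword u (x ∷ w)) (sym q++r≡w) xw)

  z-++-¬RightSpecial : ∀ q y → Subword u (q ++ y) → (∀ y₁ → ProperPrefix y₁ y → ¬ RightSpecial (q ++ y₁)) →
    z u (q ++ y) ≡ z u q
  z-++-¬RightSpecial q [] _ _ = cong (z u) (++-identityʳ q)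
  z-++-¬RightSpecial q (x ∷ y) sub unspecial = begin
    z u (q ++ x ∷ y)    ≡⟨ cong (z u) (++-assoc q [ x ] y) ⟨
    z u ((q ∷ʳ x) ++ y) ≡⟨ z-++-¬RightSpecial (q ∷ʳ x) y sub′ unspecial′ ⟩
    z u (q ∷ʳ x)        ≡⟨ z-∷ʳ-¬RightSpecial q x (subword-++ˡ (q ∷ʳ x) y sub′) ¬rs ⟩
    z u q               ∎
    where
    sub′ : Subword u ((q ∷ʳ x) ++ y)
    sub′ = subst (Subword u) (sym (++-assoc q [ x ] y)) sub
    unspecial′ : ∀ y₁ → ProperPrefix y₁ y → ¬ RightSpecial ((q ∷ʳ x) ++ y₁)
    unspecial′ y₁ (y₂ , y₂≢[] , y₁++y₂≡y) =
      unspecial (x ∷ y₁) (y₂ , y₂≢[] , cong (x ∷_) y₁++y₂≡y) ∘ subst RightSpecial (++-assoc q [ x ] y₁)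
    ¬rs : ¬ RightSpecial q
    ¬rs = unspecial [] (x ∷ y , (λ ()) , refl) ∘ subst RightSpecial (sym (++-identityʳ q))

  z-longestForkPrefix : ∀ {w p} → IsFork u (fin w) → IsLongestForkPrefix u w p →
    Σ Word λ s → Subword u s × z u p ≡ z u w + z u s
  z-longestForkPrefix _ (([] , []≢[] , _) , _) = ⊥-elim ([]≢[] refl)
  z-longestForkPrefix {w} {p} fork-w ((c ∷ y , _ , p++cy≡w) , (pa , pb , _) , longest) =
    p ∷ʳ other c , rightSpecial⇒subword (pa , pb) (other c) , (begin
      z u p                             ≡⟨ z-∷ʳ p c ⟩
      z u (p ∷ʳ c) + z u (p ∷ʳ other c) ≡⟨ cong (_+ z u (p ∷ʳ other c)) z-pc≡z-w ⟩
      z u w + z u (p ∷ʳ other c)        ∎)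
    where
    pc++y≡w : (p ∷ʳ c) ++ y ≡ w
    pc++y≡w = trans (++-assoc p [ c ] y) p++cy≡w
    unspecial : ∀ y₁ → ProperPrefix y₁ y → ¬ RightSpecial ((p ∷ʳ c) ++ y₁)
    unspecial y₁ (y₂ , y₂≢[] , y₁++y₂≡y) rs =
      <⇒≱ longer (longest q (y₂ , y₂≢[] , q++y₂≡w) (rightSpecial-prefix-of-fork fork-w q++y₂≡w rs))
      where
      q : Word
      q = (p ∷ʳ c) ++ y₁
      q++y₂≡w : q ++ y₂ ≡ w
      q++y₂≡w = trans (++-assoc (p ∷ʳ c) y₁ y₂) (trans (cong ((p ∷ʳ c) ++_) y₁++y₂≡y) pc++y≡w)
      longer : length p < length q
      longer = ≤-trans (s≤s (m≤m+n (length p) (length y₁)))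
                       (≤-reflexive (sym (trans (length-++ (p ∷ʳ c)) (cong (_+ length y₁) (length-∷ʳ p c)))))
    z-pc≡z-w : z u (p ∷ʳ c) ≡ z u w
    z-pc≡z-w = sym (subst (λ w′ → z u w′ ≡ z u (p ∷ʳ c)) pc++y≡w
      (z-++-¬RightSpecial (p ∷ʳ c) y (subst (Subword u) (sym pc++y≡w) (fork⇒subword fork-w)) unspecial))

  Ψ-bound : ¬ Periodic u → ∀ {n v} → IsForkEnumeration u n v → ∀ {w} → IsFork u (fin w) →
    ∀ j → j ≤ n → ∀ {p} → v j ≡ fin p → IsLongestForkPrefix u w p → z u p ≤ zF u (v (j ∸ 1)) + z u w
  Ψ-bound ¬per {v = v} enum {w} fork-w j j≤n vj≡p Ψ
    with s , sub , zp≡ ← z-longestForkPrefix fork-w Ψ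
    with F , fork-F , zF≡zs ← fork-of-significance ¬per s sub =
    subst (_≤ zF u (v (j ∸ 1)) + z u w) (sym (trans zp≡ (+-comm (z u w) (z u s))))
          (+-monoˡ-≤ (z u w) zs≤previous)
    where
    zs<zp : z u s < zF u (v j)
    zs<zp = subst (z u s <_) (sym (trans (cong (zF u) vj≡p) zp≡))
                  (m<n+m (z u s) (subword⇒1≤z (fork⇒subword fork-w)))
    zs≤previous : z u s ≤ zF u (v (j ∸ 1))
    zs≤previous = subst (_≤ zF u (v (j ∸ 1))) zF≡zs
      (fork-below⇒≤-previous enum j j≤n fork-F (subst (_< zF u (v j)) (sym zF≡zs) zs<zp))

proposition3p9 : (u : Word) → u ≢ [] → ¬ Periodic u →
    (n : ℕ) (v : ℕ → Fk) → IsForkEnumeration u n v →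
    (i : ℕ) → 2 ≤ i → i ≤ n →
    zF u (v (i ∸ 1)) + zF u (v (i ∸ 2)) < zF u (v i) →
    (w : Word) → v (i ∸ 1) ≡ fin w →
    (j : ℕ) → j ≤ n → (p : Word) → v j ≡ fin p → IsLongestForkPrefix u w p →
    zF u (v j) ≤ zF u (v (j ∸ 1)) + zF u (v (i ∸ 1))
proposition3p9 [] u≢[] _ _ _ _ _ _ _ _ _ _ _ _ _ _ _ = ⊥-elim (u≢[] refl)
proposition3p9 u@(x₀ ∷ xs) _ ¬per n v enum i _ i≤n _ w v[i∸1]≡w j j≤n p vj≡p Ψ
  rewrite v[i∸1]≡w | vj≡p = CyclicWord.Ψ-bound x₀ xs ¬per enum fork-w j j≤n vj≡p Ψ
  where
  fork-w : IsFork u (fin w)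
  fork-w = subst (IsFork u) v[i∸1]≡w (proj₁ enum (i ∸ 1) (≤-trans (m∸n≤m i 1) i≤n))
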